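{- Let $k\geq 2$ be an integer, $p=\frac{k}{k-1}$, and let $G=(V,E)$ be a graph on $n$ vertices with girth at least $2k+1$. Let $V_{med}=\{v\in V: n^{(k-2)/(k-1)}d_1(v)^{1/(k-1)}\leq d_{k-1}(v)\}$. Then $\|V_{med}\|_p\leq n$.
   Context: $N_i(v)$ is the set of vertices at hop distance exactly $i$ from $v$ and $d_i(v)=|N_i(v)|$ ($d_1(v)$ is the degree). For $S\subseteq V$, $\|S\|_p=\left(\sum_{v\in S}d_1(v)^p\right)^{1/p}$ (degrees taken in $G$). -}

module Defs where

open import Data.Bool using (Bool; true; false; _∧_; _∨_; not; if_then_else_; T)
open import Data.Nat as ℕ using (ℕ; zero; suc; _∸_)
open import Data.Fin using (Fin; toℕ)
open import Data.Fin.Properties using (_≟_)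
open import Data.List using (List; foldr; map; filter; length)
open import Data.List.Base using (allFin)
open import Data.Bool.ListAction using (any)
open import Data.Bool.Properties using (T?)
open import Data.Empty using (⊥)
open import Data.Product using (_×_)
open import Data.Fin using (fromℕ<)
open import Data.Nat.DivMod using (_%_; m%n<n)
open import Data.Integer using (+_)
open import Data.Rational as ℚ using (ℚ; 0ℚ; 1ℚ)
open import Relation.Nullary.Decidable using (⌊_⌋)
open import Relation.Binary.PropositionalEquality using (_≡_)
open import Function.Definitions using (Injective)

record Graph (n : ℕ) : Set where
  field
    adj     : Fin n → Fin n → Bool
    sym     : ∀ u v → adj u v ≡ adj v u
    irrefl  : ∀ v → adj v v ≡ false
open Graph public

module _ {n : ℕ} (G : Graph n) where

  within : Fin n → ℕ → Fin n → Bool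
  within v zero    u = ⌊ u ≟ v ⌋
  within v (suc j) u = within v j u ∨ any (λ w → within v j w ∧ adj G w u) (allFin n)

  inN : ℕ → Fin n → Fin n → Bool
  inN zero    v u = within v zero u
  inN (suc i) v u = within v (suc i) u ∧ not (within v i u)

  d : ℕ → Fin n → ℕ
  d i v = length (filter (λ u → T? (inN i v u)) (allFin n))

  IsCycle : (m : ℕ) → (Fin m → Fin n) → Set
  IsCycle zero    c = ⊥
  IsCycle (suc m) c =
    Injective _≡_ _≡_ c × (∀ (i : Fin (suc m)) → T (adj G (c i) (c (fromℕ< (m%n<n (suc (toℕ i)) (suc m))))))

  GirthAtLeast : ℕ → Set
  GirthAtLeast g = ∀ (m : ℕ) (c : Fin m → Fin n) → 3 ℕ.≤ m → m ℕ.< g → IsCycle m c → ⊥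

_^ℚ_ : ℚ → ℕ → ℚ
q ^ℚ zero  = 1ℚ
q ^ℚ suc m = q ℚ.* (q ^ℚ m)

ℕ→ℚ : ℕ → ℚ
ℕ→ℚ m = + m ℚ./ 1

sumℚ : {n : ℕ} → (Fin n → ℚ) → ℚ
sumℚ {n} f = foldr ℚ._+_ 0ℚ (map f (allFin n))

-- v ∈ V_med  ⟺  n^{(k-2)/(k-1)} d_1(v)^{1/(k-1)} ≤ d_{k-1}(v)
--            ⟺  n^{k-2} · d_1(v) ≤ d_{k-1}(v)^{k-1}   (raising to the power k-1 ≥ 1)
inVmed : {n : ℕ} → Graph n → ℕ → Fin n → Bool
inVmed {n} G k v = (n ℕ.^ (k ∸ 2)) ℕ.* d G 1 v ℕ.≤ᵇ (d G (k ∸ 1) v ℕ.^ (k ∸ 1))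

{-# OPTIONS --safe #-}
module Submission where

-- Write M = k − 1 and N = n^(k−2). For v ∈ V_med the hypotheses give
--   q_v^M · N ≤ d₁(v)^M · (N · d₁(v)) ≤ (d₁(v) · d_M(v))^M,
-- that is q_v · N^(1/M) ≤ d₁(v) d_M(v). Summing over v reduces the theorem to
-- ∑_v d₁(v) d_M(v) ≤ n², because (n²)^M = n^k · N. Since v ∈ N_M(w) iff w ∈ N_M(v), that sum
-- equals ∑_w ∑_{v ∈ N_M(w)} d₁(v), which counts, for each w, the edges leaving the sphere N_M(w).
-- As the girth exceeds 2k, such an edge ends in N_(M−1)(w) or N_k(w), every vertex of N_M(w) has
-- at most one neighbour in N_(M−1)(w) and every vertex of N_k(w) at most one in N_M(w); so there
-- are at most |N_M(w)| + |N_k(w)| ≤ n of them.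

open import Defs hiding (sym)
open import Data.Nat using (ℕ)

module Walks where

  open import Data.Empty using (⊥-elim)
  open import Data.List using (List; []; _∷_; _∷ʳ_; length)
  open import Data.List.Relation.Unary.All as All using (All; []; _∷_)
  open import Data.List.Relation.Unary.AllPairs using ([]; _∷_)
  open import Data.List.Relation.Unary.AllPairs.Properties using (++⁺)
  open import Data.List.Relation.Unary.Linked using (Linked; [-]; _∷_)
  open import Data.List.Relation.Unary.Unique.Propositional using (Unique)
  open import Data.Nat using (zero; suc; _≤_; s≤s)
  open import Data.Nat.DivMod using (_%_; m<n⇒m%n≡m; n%n≡0)
  open import Data.Nat.Properties using (m≤n⇒m<n∨m≡n)
  open import Data.Sum using (inj₁; inj₂)
  open import Function using (_∘_)
  open import Relation.Binary.Core using (Rel)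
  open import Relation.Binary.PropositionalEquality using (_≡_; _≢_; refl; cong; sym; trans; subst; subst₂)
  open import Relation.Nullary using (¬_)

  private variable
    A : Set
    R : Rel A _
    P : A → Set

  -- Indexes x ∷ xs; an out-of-range index gives its last entry instead of a default value.
  nth : A → List A → ℕ → A
  nth x _        zero    = x
  nth x []       (suc k) = x
  nth x (y ∷ ys) (suc k) = nth y ys k

  nth-∷ʳ : ∀ (x : A) xs y {k} → k ≤ length xs → nth x (xs ∷ʳ y) k ≡ nth x xs k
  nth-∷ʳ x xs       y {zero}  _        = refl
  nth-∷ʳ x (z ∷ zs) y {suc k} (s≤s k≤) = nth-∷ʳ z zs y k≤

  nth-∷ʳ-last : ∀ (x : A) xs y → nth x (xs ∷ʳ y) (suc (length xs)) ≡ y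
  nth-∷ʳ-last x []       y = refl
  nth-∷ʳ-last x (z ∷ zs) y = nth-∷ʳ-last z zs y

  All-nth : ∀ {x : A} {xs} → All P (x ∷ xs) → ∀ k → P (nth x xs k)
  All-nth (px ∷ _)           zero    = px
  All-nth (px ∷ [])          (suc k) = px
  All-nth (px ∷ pys@(_ ∷ _)) (suc k) = All-nth pys k

  Linked-nth : ∀ {x : A} {xs k} → Linked R (x ∷ xs) → suc k ≤ length xs → R (nth x xs k) (nth x xs (suc k))
  Linked-nth {k = zero}  (r ∷ _)  _         = r
  Linked-nth {k = suc k} (_ ∷ rs) (s≤s k<∣xs∣) = Linked-nth rs k<∣xs∣

  Unique-nth-injective : ∀ {x : A} {xs k l} → Unique (x ∷ xs) → k ≤ length xs → l ≤ length xs →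
                         nth x xs k ≡ nth x xs l → k ≡ l
  Unique-nth-injective {k = zero}  {zero}  _ _ _ _ = refl
  Unique-nth-injective {xs = _ ∷ _} {zero}  {suc l} (x∉ ∷ _) _ _ eq = ⊥-elim (All-nth x∉ l eq)
  Unique-nth-injective {xs = _ ∷ _} {suc k} {zero}  (x∉ ∷ _) _ _ eq = ⊥-elim (All-nth x∉ k (sym eq))
  Unique-nth-injective {xs = _ ∷ _} {suc k} {suc l} (_ ∷ u) (s≤s k≤) (s≤s l≤) eq =
    cong suc (Unique-nth-injective u k≤ l≤ eq)

  length-∷ʳ : ∀ (xs : List A) y → length (xs ∷ʳ y) ≡ suc (length xs)
  length-∷ʳ []       y = refl
  length-∷ʳ (x ∷ xs) y = cong suc (length-∷ʳ xs y)

  Linked-∷ʳ : ∀ {xs} {y z : A} → Linked R (xs ∷ʳ y) → R y z → Linked R (xs ∷ʳ y ∷ʳ z)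
  Linked-∷ʳ {xs = []}         [-]      r = r ∷ [-]
  Linked-∷ʳ {xs = _ ∷ []}     (s ∷ rs) r = s ∷ Linked-∷ʳ {xs = []} rs r
  Linked-∷ʳ {xs = _ ∷ x ∷ xs} (s ∷ rs) r = s ∷ Linked-∷ʳ {xs = x ∷ xs} rs r

  closed-walk-nth : ∀ {x : A} {xs k} → Linked R (x ∷ xs ∷ʳ x) → k ≤ length xs →
                    R (nth x xs k) (nth x xs (suc k % suc (length xs)))
  closed-walk-nth {R = R} {x = x} {xs} {k} walk k≤ =
    subst₂ R (nth-∷ʳ x xs x k≤) wrap (Linked-nth walk (subst (suc k ≤_) (sym (length-∷ʳ xs x)) (s≤s k≤)))
    where
    wrap : nth x (xs ∷ʳ x) (suc k) ≡ nth x xs (suc k % suc (length xs))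
    wrap with m≤n⇒m<n∨m≡n k≤
    ... | inj₁ k<∣xs∣ = trans (nth-∷ʳ x xs x k<∣xs∣) (cong (nth x xs) (sym (m<n⇒m%n≡m (s≤s k<∣xs∣))))
    ... | inj₂ refl   = trans (nth-∷ʳ-last x xs x) (cong (nth x xs) (sym (n%n≡0 (suc (length xs)))))

  All¬⇒All≢ : ∀ {x : A} {ys} → P x → All (¬_ ∘ P) ys → All (x ≢_) ys
  All¬⇒All≢ {P = P} px = All.map (λ ¬py x≡y → ¬py (subst P x≡y px))

  Unique-∷ʳ : ∀ {xs} {y : A} → Unique xs → All (y ≢_) xs → Unique (xs ∷ʳ y)
  Unique-∷ʳ u y∉ = ++⁺ u ([] ∷ []) (All.map (λ y≢x → (λ x≡y → y≢x (sym x≡y)) ∷ []) y∉)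

module Indicators where

  open import Data.Bool using (Bool; true; false; T; _∧_; not)
  open import Data.Bool.Properties using (T?)
  open import Data.Empty using (⊥; ⊥-elim)
  open import Data.Fin using (Fin; zero; suc)
  open import Data.Fin.Properties using (suc-injective; 0≢1+n)
  open import Data.List using (length; filter; tabulate)
  open import Data.Nat using (zero; suc; _+_; _*_; _≤_; z≤n; s≤s)
  open import Data.Nat.Properties using (+-mono-≤; ≤-trans; ≤-reflexive; *-identityˡ; +-0-commutativeMonoid)
  open import Algebra.Properties.CommutativeMonoid.Sum +-0-commutativeMonoid using (sum; sum-syntax; sum-replicate-zero)
  open import Data.Sum using (_⊎_; inj₁; inj₂)
  open import Function using (_∘_; _⇔_; mk⇔)
  open import Relation.Binary.PropositionalEquality using (_≡_; refl; cong; sym; subst)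
  open import Relation.Nullary using (¬_)

  T-injective : ∀ {a b} → (T a → T b) → (T b → T a) → a ≡ b
  T-injective {false} {false} _ _ = refl
  T-injective {false} {true}  _ g = ⊥-elim (g _)
  T-injective {true}  {false} f _ = ⊥-elim (f _)
  T-injective {true}  {true}  _ _ = refl

  T-not : ∀ {b} → T (not b) ⇔ (¬ T b)
  T-not {false} = mk⇔ (λ _ ()) (λ _ → _)
  T-not {true}  = mk⇔ (λ ()) (λ ¬t → ¬t _)

  ⟦_⟧ : Bool → ℕ
  ⟦ true  ⟧ = 1
  ⟦ false ⟧ = 0

  ∑-mono-≤ : ∀ {m} {f g : Fin m → ℕ} → (∀ i → f i ≤ g i) → sum f ≤ sum g
  ∑-mono-≤ {zero}  _   = z≤n
  ∑-mono-≤ {suc m} f≤g = +-mono-≤ (f≤g zero) (∑-mono-≤ (f≤g ∘ suc))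

  ∑-const : ∀ m c → ∑[ i < m ] c ≡ m * c
  ∑-const zero    c = refl
  ∑-const (suc m) c = cong (c +_) (∑-const m c)

  length-filter-tabulate : ∀ {A : Set} {m} (p : A → Bool) (f : Fin m → A) →
                           length (filter (T? ∘ p) (tabulate f)) ≡ ∑[ i < m ] ⟦ p (f i) ⟧
  length-filter-tabulate {m = zero}  p f = refl
  length-filter-tabulate {m = suc m} p f with p (f zero)
  ... | true  = cong suc (length-filter-tabulate p (f ∘ suc))
  ... | false = length-filter-tabulate p (f ∘ suc)

  ∑-⟦⟧≤1 : ∀ {m} (p : Fin m → Bool) → (∀ {i j} → T (p i) → T (p j) → i ≡ j) → ∑[ i < m ] ⟦ p i ⟧ ≤ 1
  ∑-⟦⟧≤1 {zero}  p unique = z≤n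
  ∑-⟦⟧≤1 {suc m} p unique with p zero in p₀
  ... | false = ∑-⟦⟧≤1 (p ∘ suc) (λ pi pj → suc-injective (unique pi pj))
  ... | true  = s≤s (≤-trans (∑-mono-≤ rest≤0) (≤-reflexive (sum-replicate-zero m)))
    where
    rest≤0 : ∀ i → ⟦ p (suc i) ⟧ ≤ 0
    rest≤0 i with p (suc i) in pᵢ
    ... | false = z≤n
    ... | true  = ⊥-elim (0≢1+n (unique (subst T (sym p₀) _) (subst T (sym pᵢ) _)))

  ⟦⟧*-≤ : ∀ b {m} → (T b → m ≤ 1) → ⟦ b ⟧ * m ≤ ⟦ b ⟧
  ⟦⟧*-≤ false _   = z≤n
  ⟦⟧*-≤ true  m≤1 = ≤-trans (≤-reflexive (*-identityˡ _)) (m≤1 _)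

  ⟦⟧+⟦⟧≤1 : ∀ a b → (T a → T b → ⊥) → ⟦ a ⟧ + ⟦ b ⟧ ≤ 1
  ⟦⟧+⟦⟧≤1 true  true  disjoint = ⊥-elim (disjoint _ _)
  ⟦⟧+⟦⟧≤1 true  false _        = s≤s z≤n
  ⟦⟧+⟦⟧≤1 false true  _        = s≤s z≤n
  ⟦⟧+⟦⟧≤1 false false _        = z≤n

  ⟦⟧*⟦⟧-split : ∀ l a k s → (T l → T a → T k ⊎ T s) → ⟦ l ⟧ * ⟦ a ⟧ ≤ ⟦ k ⟧ * ⟦ l ∧ a ⟧ + ⟦ l ⟧ * ⟦ a ∧ s ⟧
  ⟦⟧*⟦⟧-split false _     _     _     _ = z≤n
  ⟦⟧*⟦⟧-split true  false _     _     _ = z≤n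
  ⟦⟧*⟦⟧-split true  true  true  _     _ = s≤s z≤n
  ⟦⟧*⟦⟧-split true  true  false true  _ = s≤s z≤n
  ⟦⟧*⟦⟧-split true  true  false false k⊎s with k⊎s _ _
  ... | inj₁ ()
  ... | inj₂ ()

module GraphDistances {n : ℕ} (G : Graph n) where

  open Walks
  open Indicators using (T-injective; T-not)
  open import Data.Bool using (T; _∧_; not)
  open import Data.Bool.Properties using (T-∧; T-∨; T?)
  open import Data.Empty using (⊥; ⊥-elim)
  open import Data.Fin using (Fin; toℕ; fromℕ<)
  open import Data.Fin.Properties using (_≟_; toℕ-injective; toℕ≤pred[n]; toℕ-fromℕ<)
  open import Data.List using ([]; _∷_; _∷ʳ_; length; allFin)
  open import Data.List.Membership.Propositional using (lose)
  open import Data.List.Membership.Propositional.Properties using (∈-allFin)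
  open import Data.List.Relation.Unary.All as All using (All; []; _∷_)
  open import Data.List.Relation.Unary.All.Properties using (∷ʳ⁺)
  open import Data.List.Relation.Unary.AllPairs using ([]; _∷_)
  open import Data.List.Relation.Unary.Any using (satisfied)
  open import Data.List.Relation.Unary.Any.Properties using (any⁺; any⁻)
  open import Data.List.Relation.Unary.Linked using (Linked; [-]; _∷_)
  open import Data.List.Relation.Unary.Unique.Propositional using (Unique)
  open import Data.Nat using (zero; suc; _+_; _*_; _≤_; _<_; z≤n; s≤s)
  open import Data.Nat.DivMod using (m%n<n)
  open import Data.Nat.Properties using (≤-<-trans; +-comm; +-suc; m≤n+m)
  open import Data.Nat.Tactic.RingSolver using (solve-∀)
  open import Data.Product using (_×_; _,_; proj₁; proj₂; ∃-syntax)
  open import Data.Sum using (_⊎_; inj₁; inj₂)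
  open import Function using (_∘_; Equivalence)
  open import Relation.Binary.PropositionalEquality
  open import Relation.Nullary using (¬_; yes; no)
  open import Relation.Nullary.Decidable using (toWitness; fromWitness)

  open Equivalence using (to; from)

  V : Set
  V = Fin n

  -- The Boolean relations of Defs are wrapped in records so that their vertex arguments are inferable.
  record _~_ (u v : V) : Set where
    constructor mk~
    field adjacent : T (adj G u v)

  record Within (w : V) (j : ℕ) (u : V) : Set where
    constructor mkWithin
    field within-T : T (within G w j u)

  record InN (i : ℕ) (w u : V) : Set where
    constructor mkInN
    field inN-T : T (inN G i w u)

  open _~_ public
  open Within public
  open InN public

  ~-sym : ∀ {u v} → u ~ v → v ~ u
  ~-sym {u} {v} (mk~ e) = mk~ (subst T (Graph.sym G u v) e)

  ~-irrefl : ∀ {u} → ¬ u ~ u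
  ~-irrefl {u} (mk~ e) = subst T (Graph.irrefl G u) e

  ~⇒≢ : ∀ {u v} → u ~ v → u ≢ v
  ~⇒≢ e refl = ~-irrefl e

  within-zero : ∀ {w u} → Within w 0 u → u ≡ w
  within-zero (mkWithin h) = toWitness h

  within-refl : ∀ {w} → Within w 0 w
  within-refl = mkWithin (fromWitness refl)

  within-suc : ∀ {w j u} → Within w j u → Within w (suc j) u
  within-suc (mkWithin h) = mkWithin (from T-∨ (inj₁ h))

  within-step : ∀ {w j u x} → Within w j u → u ~ x → Within w (suc j) x
  within-step {u = u} (mkWithin h) (mk~ e) =
    mkWithin (from T-∨ (inj₂ (any⁺ _ (lose (∈-allFin u) (from T-∧ (h , e))))))

  within-split : ∀ {w j u} → Within w (suc j) u → Within w j u ⊎ ∃[ x ] Within w j x × x ~ u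
  within-split (mkWithin h) with to T-∨ h
  ... | inj₁ h′ = inj₁ (mkWithin h′)
  ... | inj₂ h′ with x , p ← satisfied (any⁻ _ (allFin n) h′) with h″ , e ← to T-∧ p =
    inj₂ (x , mkWithin h″ , mk~ e)

  within-cons : ∀ {v w j u} → v ~ w → Within w j u → Within v (suc j) u
  within-cons {j = zero}  e h with refl ← within-zero h = within-step within-refl e
  within-cons {j = suc j} e h with within-split h
  ... | inj₁ h′            = within-suc (within-cons e h′)
  ... | inj₂ (x , h′ , e′) = within-step (within-cons e h′) e′

  within-sym : ∀ {w j u} → Within w j u → Within u j w
  within-sym {j = zero}  h with refl ← within-zero h = within-refl
  within-sym {j = suc j} h with within-split h
  ... | inj₁ h′           = within-suc (within-sym h′)
  ... | inj₂ (x , h′ , e) = within-cons (~-sym e) (within-sym h′)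

  within-sym-≡ : ∀ w j u → within G w j u ≡ within G u j w
  within-sym-≡ w j u = T-injective (λ h → within-T (within-sym {w} {j} {u} (mkWithin h)))
                                   (λ h → within-T (within-sym {u} {j} {w} (mkWithin h)))

  inN-sym : ∀ i w u → inN G i w u ≡ inN G i u w
  inN-sym zero    w u = within-sym-≡ w zero u
  inN-sym (suc i) w u = cong₂ (λ a b → a ∧ not b) (within-sym-≡ w (suc i) u) (within-sym-≡ w i u)

  InN⇒Within : ∀ {i w u} → InN i w u → Within w i u
  InN⇒Within {zero}  (mkInN h) = mkWithin h
  InN⇒Within {suc i} (mkInN h) = mkWithin (proj₁ (to T-∧ h))

  InN⇒¬Within : ∀ {i w u} → InN (suc i) w u → ¬ Within w i u
  InN⇒¬Within (mkInN h) (mkWithin h′) = to T-not (proj₂ (to T-∧ h)) h′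

  InN-zero : ∀ {w u} → Within w 0 u → InN 0 w u
  InN-zero (mkWithin h) = mkInN h

  InN-suc : ∀ {i w u} → Within w (suc i) u → ¬ Within w i u → InN (suc i) w u
  InN-suc (mkWithin h) ¬h = mkInN (from T-∧ (h , from T-not (¬h ∘ mkWithin)))

  parent : ∀ {i w u} → InN (suc i) w u → ∃[ p ] InN i w p × p ~ u
  parent h with within-split (InN⇒Within h)
  ... | inj₁ h′ = ⊥-elim (InN⇒¬Within h h′)
  parent {zero}  h | inj₂ (p , hp , e) = p , InN-zero hp , e
  parent {suc i} h | inj₂ (p , hp , e) = p , InN-suc hp (λ hp′ → InN⇒¬Within h (within-step hp′ e)) , e

  inN-one : ∀ w u → inN G 1 w u ≡ adj G w u
  inN-one w u = T-injective ⇒adj adj⇒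
    where
    ⇒adj : T (inN G 1 w u) → T (adj G w u)
    ⇒adj h with p , hp , e ← parent {0} {w} {u} (mkInN h) with refl ← within-zero (InN⇒Within hp) = adjacent e
    adj⇒ : T (adj G w u) → T (inN G 1 w u)
    adj⇒ e = inN-T (InN-suc (within-step within-refl (mk~ e)) (λ h → ~-irrefl (subst (w ~_) (within-zero h) (mk~ e))))

  InN-below : ∀ {i w v x} → InN (suc i) w v → v ~ x → Within w i x → InN i w x
  InN-below {zero}  _  _ h = InN-zero h
  InN-below {suc i} hv e h = InN-suc h (λ h′ → InN⇒¬Within hv (within-step h′ (~-sym e)))

  InN-neighbour : ∀ {i w v x} → InN (suc i) w v → v ~ x → InN i w x ⊎ InN (suc i) w x ⊎ InN (suc (suc i)) w x
  InN-neighbour {i} {w} {v} {x} hv e with T? (within G w (suc i) x) | T? (within G w i x)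
  ... | no ¬h₁ | _      = inj₂ (inj₂ (InN-suc (within-step (InN⇒Within hv) e) (¬h₁ ∘ within-T)))
  ... | yes h₁ | no ¬h₀ = inj₂ (inj₁ (InN-suc (mkWithin h₁) (¬h₀ ∘ within-T)))
  ... | yes _  | yes h₀ = inj₁ (InN-below hv e (mkWithin h₀))

  closed-walk⇒IsCycle : ∀ x cs → Linked _~_ (x ∷ cs ∷ʳ x) → Unique (x ∷ cs) →
                        IsCycle G (suc (length cs)) (λ i → nth x cs (toℕ i))
  closed-walk⇒IsCycle x cs walk distinct = injective , adjacent-next
    where
    injective : ∀ {i j} → nth x cs (toℕ i) ≡ nth x cs (toℕ j) → i ≡ j
    injective {i} {j} eq = toℕ-injective (Unique-nth-injective distinct (toℕ≤pred[n] i) (toℕ≤pred[n] j) eq)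
    adjacent-next : ∀ (i : Fin (suc (length cs))) →
                    T (adj G (nth x cs (toℕ i)) (nth x cs (toℕ (fromℕ< (m%n<n (suc (toℕ i)) (suc (length cs)))))))
    adjacent-next i = adjacent (subst (nth x cs (toℕ i) ~_)
      (cong (nth x cs) (sym (toℕ-fromℕ< (m%n<n (suc (toℕ i)) (suc (length cs))))))
      (closed-walk-nth walk (toℕ≤pred[n] i)))

  module _ {g} (girth : GirthAtLeast G g) (w : V) where

    -- If x₁ ≠ x₂ lie on N_i(w) and are joined by a path through mid outside the ball B_i(w), then
    -- following parents back towards w closes a cycle no longer than the closed walk w ⇝ x₁ ⇝ x₂ ⇝ w.
    no-short-bridge : ∀ i {x₁ x₂} mid → InN i w x₁ → InN i w x₂ → x₁ ≢ x₂ →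
                      All (¬_ ∘ Within w i) mid → Unique mid → Linked _~_ (x₁ ∷ mid ∷ʳ x₂) →
                      2 * i + length mid + 1 < g → ⊥
    no-short-bridge zero mid h₁ h₂ x₁≢x₂ _ _ _ _ =
      x₁≢x₂ (trans (within-zero (InN⇒Within h₁)) (sym (within-zero (InN⇒Within h₂))))
    no-short-bridge (suc i) {x₁} {x₂} mid h₁ h₂ x₁≢x₂ outside distinct walk short =
      climb (parent h₁) (parent h₂)
      where
      mid′ = x₁ ∷ mid ∷ʳ x₂

      outside′ : All (¬_ ∘ Within w i) mid′
      outside′ = InN⇒¬Within h₁ ∷ ∷ʳ⁺ (All.map (_∘ within-suc) outside) (InN⇒¬Within h₂)

      distinct′ : Unique mid′
      distinct′ = ∷ʳ⁺ (All¬⇒All≢ (InN⇒Within h₁) outside) x₁≢x₂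
                ∷ Unique-∷ʳ distinct (All¬⇒All≢ (InN⇒Within h₂) outside)

      length-mid′ : length mid′ ≡ 2 + length mid
      length-mid′ = cong suc (length-∷ʳ mid x₂)

      short′ : 2 * i + length mid′ + 1 < g
      short′ = subst (_< g) (trans (shape i (length mid)) (cong (λ l → 2 * i + l + 1) (sym length-mid′))) short
        where
        shape : ∀ i l → 2 * suc i + l + 1 ≡ 2 * i + (2 + l) + 1
        shape = solve-∀

      cycle≥3 : 3 ≤ suc (length mid′)
      cycle≥3 = s≤s (subst (2 ≤_) (sym length-mid′) (s≤s (s≤s z≤n)))

      cycle<g : suc (length mid′) < g
      cycle<g = ≤-<-trans (subst (suc (length mid′) ≤_) (trans (+-suc _ _) (+-comm 1 _)) (m≤n+m _ (2 * i))) short′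

      climb : ∃[ p ] InN i w p × p ~ x₁ → ∃[ p ] InN i w p × p ~ x₂ → ⊥
      climb (p₁ , hp₁ , e₁) (p₂ , hp₂ , e₂) with p₁ ≟ p₂ | e₁ ∷ Linked-∷ʳ {xs = x₁ ∷ mid} walk (~-sym e₂)
      ... | no p₁≢p₂ | walk′ = no-short-bridge i mid′ hp₁ hp₂ p₁≢p₂ outside′ distinct′ walk′ short′
      ... | yes refl | walk′ = girth _ _ cycle≥3 cycle<g
                                 (closed-walk⇒IsCycle p₁ mid′ walk′ (All¬⇒All≢ (InN⇒Within hp₁) outside′ ∷ distinct′))

    InN-independent : ∀ {i u v} → 2 * i + 2 ≤ g → InN i w u → InN i w v → ¬ u ~ v
    InN-independent {i} bound hu hv e =
      no-short-bridge i [] hu hv (~⇒≢ e) [] [] (e ∷ [-]) (subst (_≤ g) (shape i) bound)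
      where
      shape : ∀ i → 2 * i + 2 ≡ suc (2 * i + 0 + 1)
      shape = solve-∀

    unique-parent : ∀ {i v x₁ x₂} → 2 * i + 3 ≤ g → InN (suc i) w v → InN i w x₁ → InN i w x₂ →
                    v ~ x₁ → v ~ x₂ → x₁ ≡ x₂
    unique-parent {i} {v} {x₁} {x₂} bound hv h₁ h₂ e₁ e₂ with x₁ ≟ x₂
    ... | yes x₁≡x₂ = x₁≡x₂
    ... | no  x₁≢x₂ = ⊥-elim (no-short-bridge i (v ∷ []) h₁ h₂ x₁≢x₂ (InN⇒¬Within hv ∷ []) ([] ∷ [])
                                (~-sym e₁ ∷ e₂ ∷ [-]) (subst (_≤ g) (shape i) bound))
      where
      shape : ∀ i → 2 * i + 3 ≡ suc (2 * i + 1 + 1)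
      shape = solve-∀

module EdgeCounting {n : ℕ} (G : Graph n) where

  open Indicators
  open GraphDistances G
  open import Data.Bool using (Bool; T; _∧_)
  open import Data.Bool.Properties using (T-∧)
  open import Data.Empty using (⊥-elim)
  open import Data.Nat using (suc; _+_; _*_; _≤_; s≤s; z≤n)
  open import Data.Nat.Properties
    using (≤-reflexive; +-mono-≤; +-monoʳ-≤; *-comm; *-identityʳ; +-0-commutativeMonoid; +-*-semiring; module ≤-Reasoning)
  open import Algebra.Properties.CommutativeMonoid.Sum +-0-commutativeMonoid using (sum; sum-syntax; ∑-comm; ∑-distrib-+; sum-cong-≗)
  open import Algebra.Properties.Semiring.Sum +-*-semiring using (*-distribˡ-sum)
  open import Data.Nat.Tactic.RingSolver using (solve-∀)
  open import Data.Product using (proj₁; proj₂)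
  open import Data.Sum using (_⊎_; inj₁; inj₂)
  open import Function using (id; Equivalence)
  open import Relation.Binary.PropositionalEquality

  open Equivalence using (to)

  d-as-∑ : ∀ i v → d G i v ≡ ∑[ u < n ] ⟦ inN G i v u ⟧
  d-as-∑ i v = length-filter-tabulate (inN G i v) id

  degree-as-∑ : ∀ v → d G 1 v ≡ ∑[ u < n ] ⟦ adj G v u ⟧
  degree-as-∑ v = trans (d-as-∑ 1 v) (sum-cong-≗ (λ u → cong ⟦_⟧ (inN-one v u)))

  module _ {i} (girth : GirthAtLeast G (2 * i + 5)) (w : V) where

    private
      Nᵢ Nᵢ₊₁ Nᵢ₊₂ : V → Bool
      Nᵢ   = inN G i w
      Nᵢ₊₁ = inN G (suc i) w
      Nᵢ₊₂ = inN G (suc (suc i)) w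

      shape₁ : ∀ i → 2 * i + 4 ≡ 2 * suc i + 2
      shape₁ = solve-∀
      shape₂ : ∀ i → 2 * i + 5 ≡ 2 * suc i + 3
      shape₂ = solve-∀

    neighbour-of-Nᵢ₊₁ : ∀ v x → T (Nᵢ₊₁ v) → T (adj G v x) → T (Nᵢ₊₂ x) ⊎ T (Nᵢ x)
    neighbour-of-Nᵢ₊₁ v x hv e with InN-neighbour (mkInN hv) (mk~ e)
    ... | inj₁ x∈Nᵢ          = inj₂ (inN-T x∈Nᵢ)
    ... | inj₂ (inj₂ x∈Nᵢ₊₂) = inj₁ (inN-T x∈Nᵢ₊₂)
    ... | inj₂ (inj₁ x∈Nᵢ₊₁) = ⊥-elim (InN-independent girth w bound (mkInN hv) x∈Nᵢ₊₁ (mk~ e))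
      where
      bound : 2 * suc i + 2 ≤ 2 * i + 5
      bound = subst (_≤ 2 * i + 5) (shape₁ i) (+-monoʳ-≤ (2 * i) (s≤s (s≤s (s≤s (s≤s z≤n)))))

    ∑-parents≤1 : ∀ x → T (Nᵢ₊₂ x) → ∑[ v < n ] ⟦ Nᵢ₊₁ v ∧ adj G v x ⟧ ≤ 1
    ∑-parents≤1 x hx = ∑-⟦⟧≤1 _ λ h₁ h₂ →
      unique-parent girth w (≤-reflexive (sym (shape₂ i))) (mkInN hx) (onNᵢ₊₁ h₁) (onNᵢ₊₁ h₂) (edge h₁) (edge h₂)
      where
      onNᵢ₊₁ : ∀ {v} → T (Nᵢ₊₁ v ∧ adj G v x) → InN (suc i) w v
      onNᵢ₊₁ h = mkInN (proj₁ (to T-∧ h))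
      edge : ∀ {v} → T (Nᵢ₊₁ v ∧ adj G v x) → x ~ v
      edge {v} h = ~-sym (mk~ (proj₂ (to (T-∧ {Nᵢ₊₁ v}) h)))

    ∑-lower-neighbours≤1 : ∀ v → T (Nᵢ₊₁ v) → ∑[ x < n ] ⟦ adj G v x ∧ Nᵢ x ⟧ ≤ 1
    ∑-lower-neighbours≤1 v hv = ∑-⟦⟧≤1 _ λ h₁ h₂ →
      unique-parent girth w (+-monoʳ-≤ (2 * i) (s≤s (s≤s (s≤s z≤n)))) (mkInN hv) (onNᵢ h₁) (onNᵢ h₂) (edge h₁) (edge h₂)
      where
      onNᵢ : ∀ {x} → T (adj G v x ∧ Nᵢ x) → InN i w x
      onNᵢ {x} h = mkInN (proj₂ (to (T-∧ {adj G v x}) h))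
      edge : ∀ {x} → T (adj G v x ∧ Nᵢ x) → v ~ x
      edge h = mk~ (proj₁ (to T-∧ h))

    ∑-degree-over-Nᵢ₊₁≤n : ∑[ v < n ] (⟦ Nᵢ₊₁ v ⟧ * d G 1 v) ≤ n
    ∑-degree-over-Nᵢ₊₁≤n = begin
      ∑[ v < n ] (⟦ Nᵢ₊₁ v ⟧ * d G 1 v)
        ≡⟨ sum-cong-≗ (λ v → trans (cong (⟦ Nᵢ₊₁ v ⟧ *_) (degree-as-∑ v)) (*-distribˡ-sum ⟦ Nᵢ₊₁ v ⟧ (λ x → ⟦ adj G v x ⟧))) ⟩
      ∑[ v < n ] ∑[ x < n ] (⟦ Nᵢ₊₁ v ⟧ * ⟦ adj G v x ⟧)
        ≤⟨ ∑-mono-≤ (λ v → ∑-mono-≤ (λ x → ⟦⟧*⟦⟧-split (Nᵢ₊₁ v) (adj G v x) (Nᵢ₊₂ x) (Nᵢ x) (neighbour-of-Nᵢ₊₁ v x))) ⟩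
      ∑[ v < n ] ∑[ x < n ] (up v x + down v x)
        ≡⟨ trans (sum-cong-≗ (λ v → ∑-distrib-+ (up v) (down v))) (∑-distrib-+ (λ v → ∑[ x < n ] up v x) (λ v → ∑[ x < n ] down v x)) ⟩
      ∑[ v < n ] ∑[ x < n ] up v x + ∑[ v < n ] ∑[ x < n ] down v x
        ≡⟨ cong (_+ ∑[ v < n ] ∑[ x < n ] down v x) (∑-comm up) ⟩
      ∑[ x < n ] ∑[ v < n ] up v x + ∑[ v < n ] ∑[ x < n ] down v x
        ≡⟨ sym (cong₂ _+_ (sum-cong-≗ (λ x → *-distribˡ-sum ⟦ Nᵢ₊₂ x ⟧ (λ v → ⟦ Nᵢ₊₁ v ∧ adj G v x ⟧)))
                          (sum-cong-≗ (λ v → *-distribˡ-sum ⟦ Nᵢ₊₁ v ⟧ (λ x → ⟦ adj G v x ∧ Nᵢ x ⟧)))) ⟩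
      ∑[ x < n ] (⟦ Nᵢ₊₂ x ⟧ * ∑[ v < n ] ⟦ Nᵢ₊₁ v ∧ adj G v x ⟧) + ∑[ v < n ] (⟦ Nᵢ₊₁ v ⟧ * ∑[ x < n ] ⟦ adj G v x ∧ Nᵢ x ⟧)
        ≤⟨ +-mono-≤ (∑-mono-≤ (λ x → ⟦⟧*-≤ (Nᵢ₊₂ x) (∑-parents≤1 x)))
                    (∑-mono-≤ (λ v → ⟦⟧*-≤ (Nᵢ₊₁ v) (∑-lower-neighbours≤1 v))) ⟩
      ∑[ x < n ] ⟦ Nᵢ₊₂ x ⟧ + ∑[ x < n ] ⟦ Nᵢ₊₁ x ⟧
        ≡⟨ sym (∑-distrib-+ (λ x → ⟦ Nᵢ₊₂ x ⟧) (λ x → ⟦ Nᵢ₊₁ x ⟧)) ⟩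
      ∑[ x < n ] (⟦ Nᵢ₊₂ x ⟧ + ⟦ Nᵢ₊₁ x ⟧)
        ≤⟨ ∑-mono-≤ (λ x → ⟦⟧+⟦⟧≤1 (Nᵢ₊₂ x) (Nᵢ₊₁ x) (λ x∈Nᵢ₊₂ x∈Nᵢ₊₁ → InN⇒¬Within (mkInN {suc (suc i)} {w} {x} x∈Nᵢ₊₂) (InN⇒Within (mkInN x∈Nᵢ₊₁)))) ⟩
      ∑[ x < n ] 1
        ≡⟨ trans (∑-const n 1) (*-identityʳ n) ⟩
      n ∎
      where
      open ≤-Reasoning
      up down : V → V → ℕ
      up   v x = ⟦ Nᵢ₊₂ x ⟧ * ⟦ Nᵢ₊₁ v ∧ adj G v x ⟧
      down v x = ⟦ Nᵢ₊₁ v ⟧ * ⟦ adj G v x ∧ Nᵢ x ⟧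

  ∑-degree*d≤n² : ∀ {i} → GirthAtLeast G (2 * i + 5) → ∑[ v < n ] (d G 1 v * d G (suc i) v) ≤ n * n
  ∑-degree*d≤n² {i} girth = begin
    ∑[ v < n ] (d G 1 v * d G (suc i) v)
      ≡⟨ sum-cong-≗ (λ v → trans (cong (d G 1 v *_) (d-as-∑ (suc i) v)) (*-distribˡ-sum (d G 1 v) (λ u → ⟦ inN G (suc i) v u ⟧))) ⟩
    ∑[ v < n ] ∑[ u < n ] (d G 1 v * ⟦ inN G (suc i) v u ⟧)
      ≡⟨ ∑-comm (λ v u → d G 1 v * ⟦ inN G (suc i) v u ⟧) ⟩
    ∑[ u < n ] ∑[ v < n ] (d G 1 v * ⟦ inN G (suc i) v u ⟧)
      ≡⟨ sum-cong-≗ (λ u → sum-cong-≗ (λ v → trans (*-comm (d G 1 v) _) (cong (λ b → ⟦ b ⟧ * d G 1 v) (inN-sym (suc i) v u)))) ⟩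
    ∑[ u < n ] ∑[ v < n ] (⟦ inN G (suc i) u v ⟧ * d G 1 v)
      ≤⟨ ∑-mono-≤ (∑-degree-over-Nᵢ₊₁≤n {i} girth) ⟩
    ∑[ u < n ] n
      ≡⟨ ∑-const n n ⟩
    n * n ∎
    where open ≤-Reasoning

module RationalFacts where

  open import Algebra.Bundles using (CommutativeRing)
  open import Data.Fin using (Fin; zero; suc)
  open import Data.Integer as ℤ using (+≤+; +<+)
  import Data.Integer.Properties as ℤₚ
  open import Data.List using (foldr; tabulate)
  open import Data.List.Properties using (map-tabulate)
  open import Data.Nat as ℕ using (zero; suc)
  import Data.Nat.Coprimality as Coprime
  import Data.Nat.Properties as ℕₚ
  open import Data.Product using (∃-syntax; _,_)
  open import Data.Rational using (ℚ; 0ℚ; mkℚ; _/_; _+_; _*_; _≤_; _<_; *≤*; *<*; nonNegative; positive)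
  open import Data.Rational.Properties
  open import Function using (_∘_; id)
  open import Relation.Binary.PropositionalEquality
  open import Relation.Nullary using (yes; no; contradiction)
  open import Algebra.Properties.CommutativeMonoid.Sum +-0-commutativeMonoid using (sum; sum-syntax)
  open import Algebra.Properties.CommutativeSemigroup (CommutativeRing.*-commutativeSemigroup +-*-commutativeRing)
    using (interchange)
  open import Algebra.Properties.Semiring.Sum (CommutativeRing.semiring +-*-commutativeRing) using (*-distribʳ-sum)
  import Algebra.Properties.CommutativeMonoid.Sum ℕₚ.+-0-commutativeMonoid as ℕΣ

  ℕ→ℚ≡mkℚ : ∀ m → ℕ→ℚ m ≡ mkℚ (ℤ.+ m) 0 (Coprime.sym (Coprime.1-coprimeTo m))
  ℕ→ℚ≡mkℚ m = ↥p/↧p≡p (mkℚ (ℤ.+ m) 0 (Coprime.sym (Coprime.1-coprimeTo m)))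

  ℕ→ℚ-homo-+ : ∀ a b → ℕ→ℚ (a ℕ.+ b) ≡ ℕ→ℚ a + ℕ→ℚ b
  ℕ→ℚ-homo-+ a b = trans (cong (_/ 1) numerator) (cong₂ _+_ (sym (ℕ→ℚ≡mkℚ a)) (sym (ℕ→ℚ≡mkℚ b)))
    where
    numerator : ℤ.+ (a ℕ.+ b) ≡ ℤ.+ a ℤ.* ℤ.+ 1 ℤ.+ ℤ.+ b ℤ.* ℤ.+ 1
    numerator = trans (ℤₚ.pos-+ a b) (sym (cong₂ ℤ._+_ (ℤₚ.*-identityʳ (ℤ.+ a)) (ℤₚ.*-identityʳ (ℤ.+ b))))

  ℕ→ℚ-homo-* : ∀ a b → ℕ→ℚ (a ℕ.* b) ≡ ℕ→ℚ a * ℕ→ℚ b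
  ℕ→ℚ-homo-* a b = trans (cong (_/ 1) (ℤₚ.pos-* a b)) (cong₂ _*_ (sym (ℕ→ℚ≡mkℚ a)) (sym (ℕ→ℚ≡mkℚ b)))

  ℕ→ℚ-homo-^ : ∀ a m → ℕ→ℚ (a ℕ.^ m) ≡ ℕ→ℚ a ^ℚ m
  ℕ→ℚ-homo-^ a zero    = refl
  ℕ→ℚ-homo-^ a (suc m) = trans (ℕ→ℚ-homo-* a (a ℕ.^ m)) (cong (ℕ→ℚ a *_) (ℕ→ℚ-homo-^ a m))

  ℕ→ℚ-homo-∑ : ∀ {m} (f : Fin m → ℕ) → ℕ→ℚ (ℕΣ.sum f) ≡ ∑[ i < m ] ℕ→ℚ (f i)
  ℕ→ℚ-homo-∑ {zero}  f = refl
  ℕ→ℚ-homo-∑ {suc m} f = trans (ℕ→ℚ-homo-+ (f zero) _) (cong (ℕ→ℚ (f zero) +_) (ℕ→ℚ-homo-∑ (f ∘ suc)))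

  ℕ→ℚ-mono-≤ : ∀ {a b} → a ℕ.≤ b → ℕ→ℚ a ≤ ℕ→ℚ b
  ℕ→ℚ-mono-≤ {a} {b} a≤b = subst₂ _≤_ (sym (ℕ→ℚ≡mkℚ a)) (sym (ℕ→ℚ≡mkℚ b))
    (*≤* (subst₂ ℤ._≤_ (sym (ℤₚ.*-identityʳ (ℤ.+ a))) (sym (ℤₚ.*-identityʳ (ℤ.+ b))) (+≤+ a≤b)))

  ℕ→ℚ-nonNeg : ∀ a → 0ℚ ≤ ℕ→ℚ a
  ℕ→ℚ-nonNeg a = ℕ→ℚ-mono-≤ (ℕ.z≤n {a})

  ℕ→ℚ-pos : ∀ {a} → 0 ℕ.< a → 0ℚ < ℕ→ℚ a
  ℕ→ℚ-pos {a} 0<a = <-≤-trans (*<* (+<+ (ℕ.s≤s ℕ.z≤n))) (ℕ→ℚ-mono-≤ {1} {a} 0<a)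

  *-nonNeg : ∀ {a b} → 0ℚ ≤ a → 0ℚ ≤ b → 0ℚ ≤ a * b
  *-nonNeg {a} {b} 0≤a 0≤b = nonNegative⁻¹ _ {{nonNeg*nonNeg⇒nonNeg a {{nonNegative 0≤a}} b {{nonNegative 0≤b}}}}

  *-pos : ∀ {a b} → 0ℚ < a → 0ℚ < b → 0ℚ < a * b
  *-pos {a} {b} 0<a 0<b = positive⁻¹ _ {{pos*pos⇒pos a {{positive 0<a}} b {{positive 0<b}}}}

  ^ℚ-nonNeg : ∀ {a} m → 0ℚ ≤ a → 0ℚ ≤ a ^ℚ m
  ^ℚ-nonNeg zero    _   = ℕ→ℚ-nonNeg 1
  ^ℚ-nonNeg (suc m) 0≤a = *-nonNeg 0≤a (^ℚ-nonNeg m 0≤a)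

  ^ℚ-pos : ∀ {a} m → 0ℚ < a → 0ℚ < a ^ℚ m
  ^ℚ-pos zero    _   = ℕ→ℚ-pos {1} (ℕ.s≤s ℕ.z≤n)
  ^ℚ-pos (suc m) 0<a = *-pos 0<a (^ℚ-pos m 0<a)

  ^ℚ-monoˡ-≤ : ∀ {a b} m → 0ℚ ≤ a → a ≤ b → a ^ℚ m ≤ b ^ℚ m
  ^ℚ-monoˡ-≤ zero    _   _   = ≤-refl
  ^ℚ-monoˡ-≤ {a} {b} (suc m) 0≤a a≤b = ≤-trans
    (*-monoʳ-≤-nonNeg (a ^ℚ m) {{nonNegative (^ℚ-nonNeg m 0≤a)}} a≤b)
    (*-monoˡ-≤-nonNeg b {{nonNegative (≤-trans 0≤a a≤b)}} (^ℚ-monoˡ-≤ m 0≤a a≤b))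

  ^ℚ-cancelˡ-< : ∀ {a b} m → 0ℚ ≤ b → a ^ℚ m < b ^ℚ m → a < b
  ^ℚ-cancelˡ-< {a} {b} m 0≤b aᵐ<bᵐ with a <? b
  ... | yes a<b = a<b
  ... | no  a≮b = contradiction (<-≤-trans aᵐ<bᵐ (^ℚ-monoˡ-≤ m 0≤b (≮⇒≥ a≮b))) (<-irrefl refl)

  ^ℚ-distrib-* : ∀ a b m → (a * b) ^ℚ m ≡ a ^ℚ m * b ^ℚ m
  ^ℚ-distrib-* a b zero    = refl
  ^ℚ-distrib-* a b (suc m) = trans (cong ((a * b) *_) (^ℚ-distrib-* a b m)) (interchange a b (a ^ℚ m) (b ^ℚ m))

  0^ℚsuc : ∀ m → 0ℚ ^ℚ suc m ≡ 0ℚ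
  0^ℚsuc m = *-zeroˡ (0ℚ ^ℚ m)

  0^ℚsuc-zeroˡ : ∀ m r → 0ℚ ^ℚ suc m * r ≡ 0ℚ ^ℚ suc m
  0^ℚsuc-zeroˡ m r = trans (cong (_* r) (0^ℚsuc m)) (trans (*-zeroˡ r) (sym (0^ℚsuc m)))

  foldr-tabulate : ∀ {m} (f : Fin m → ℚ) → foldr _+_ 0ℚ (tabulate f) ≡ ∑[ i < m ] f i
  foldr-tabulate {zero}  f = refl
  foldr-tabulate {suc m} f = cong (f zero +_) (foldr-tabulate (f ∘ suc))

  sumℚ≡∑ : ∀ {m} (f : Fin m → ℚ) → sumℚ f ≡ ∑[ i < m ] f i
  sumℚ≡∑ f = trans (cong (foldr _+_ 0ℚ) (map-tabulate id f)) (foldr-tabulate f)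

  ∑-mono-≤ : ∀ {m} {f g : Fin m → ℚ} → (∀ i → f i ≤ g i) → sum f ≤ sum g
  ∑-mono-≤ {zero}  _   = ≤-refl
  ∑-mono-≤ {suc m} f≤g = +-mono-≤ (f≤g zero) (∑-mono-≤ (f≤g ∘ suc))

  ∑-nonNeg : ∀ {m} {f : Fin m → ℚ} → (∀ i → 0ℚ ≤ f i) → 0ℚ ≤ sum f
  ∑-nonNeg {zero}  _   = ≤-refl
  ∑-nonNeg {suc m} {f} 0≤f = subst (_≤ sum f) (+-identityˡ 0ℚ) (+-mono-≤ (0≤f zero) (∑-nonNeg (0≤f ∘ suc)))

  ∑-mono-< : ∀ {m} {f g : Fin m → ℚ} → (∀ i → f i ≤ g i) → (j : Fin m) → f j < g j → sum f < sum g
  ∑-mono-< f≤g zero    fj<gj = +-mono-<-≤ fj<gj (∑-mono-≤ (f≤g ∘ suc))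
  ∑-mono-< f≤g (suc j) fj<gj = +-mono-≤-< (f≤g zero) (∑-mono-< (f≤g ∘ suc) j fj<gj)

  ∑-pos⇒∃-pos : ∀ {m} (f : Fin m → ℚ) → 0ℚ < sum f → ∃[ i ] 0ℚ < f i
  ∑-pos⇒∃-pos {zero}  f 0<0 = contradiction 0<0 (<-irrefl refl)
  ∑-pos⇒∃-pos {suc m} f 0<∑ with 0ℚ <? f zero
  ... | yes 0<f₀ = zero , 0<f₀
  ... | no  0≮f₀ = let i , 0<fᵢ = ∑-pos⇒∃-pos (f ∘ suc) (<-≤-trans 0<∑ ∑≤∑tail) in suc i , 0<fᵢ
    where
    ∑≤∑tail : sum f ≤ sum (f ∘ suc)
    ∑≤∑tail = subst (sum f ≤_) (+-identityˡ _) (+-monoˡ-≤ (sum (f ∘ suc)) (≮⇒≥ 0≮f₀))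

  -- Summing a v · N^(1/M) ≤ x v without M-th roots: were the conclusion false, then
  -- a v · ∑ x < x v · ∑ a whenever a v > 0, and summing over v would give ∑ a · ∑ x < ∑ x · ∑ a.
  ∑-scaled-^-mono : ∀ {k} m (N : ℚ) (a x : Fin k → ℚ) → (∀ v → 0ℚ ≤ a v) → (∀ v → 0ℚ ≤ x v) →
                    (∀ v → a v ^ℚ suc m * N ≤ x v ^ℚ suc m) → sum a ^ℚ suc m * N ≤ sum x ^ℚ suc m
  ∑-scaled-^-mono {k} m N a x 0≤a 0≤x aᴹN≤xᴹ with sum a ^ℚ suc m * N ≤? sum x ^ℚ suc m
  ... | yes AᴹN≤Xᴹ = AᴹN≤Xᴹ
  ... | no  AᴹN≰Xᴹ = contradiction (subst₂ _<_ (sym (*-distribʳ-sum X a)) (sym (*-distribʳ-sum A x)) ∑aX<∑xA)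
                                   (<-irrefl (*-comm A X))
    where
    M = suc m
    A = sum a
    X = sum x

    0≤A : 0ℚ ≤ A
    0≤A = ∑-nonNeg 0≤a

    Xᴹ<AᴹN : X ^ℚ M < A ^ℚ M * N
    Xᴹ<AᴹN = ≰⇒> AᴹN≰Xᴹ

    0<A : 0ℚ < A
    0<A with 0ℚ <? A
    ... | yes 0<A = 0<A
    ... | no  0≮A = contradiction (≤-<-trans (^ℚ-nonNeg M (∑-nonNeg 0≤x)) Xᴹ<AᴹN) (<-irrefl (sym AᴹN≡0))
      where
      AᴹN≡0 : A ^ℚ M * N ≡ 0ℚ
      AᴹN≡0 = trans (cong (λ z → z ^ℚ M * N) (≤-antisym (≮⇒≥ 0≮A) 0≤A)) (trans (0^ℚsuc-zeroˡ m N) (0^ℚsuc m))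

    strict : ∀ v → 0ℚ < a v → a v * X < x v * A
    strict v 0<av = ^ℚ-cancelˡ-< M (*-nonNeg (0≤x v) 0≤A) (begin-strict
      (a v * X) ^ℚ M              ≡⟨ ^ℚ-distrib-* (a v) X M ⟩
      a v ^ℚ M * X ^ℚ M           <⟨ *-monoʳ-<-pos (a v ^ℚ M) {{positive (^ℚ-pos M 0<av)}} Xᴹ<AᴹN ⟩
      a v ^ℚ M * (A ^ℚ M * N)     ≡⟨ trans (cong (a v ^ℚ M *_) (*-comm (A ^ℚ M) N)) (sym (*-assoc (a v ^ℚ M) N (A ^ℚ M))) ⟩
      a v ^ℚ M * N * A ^ℚ M       ≤⟨ *-monoʳ-≤-nonNeg (A ^ℚ M) {{nonNegative (^ℚ-nonNeg M 0≤A)}} (aᴹN≤xᴹ v) ⟩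
      x v ^ℚ M * A ^ℚ M           ≡⟨ sym (^ℚ-distrib-* (x v) A M) ⟩
      (x v * A) ^ℚ M              ∎)
      where open ≤-Reasoning

    weak : ∀ v → a v * X ≤ x v * A
    weak v with 0ℚ <? a v
    ... | yes 0<av = <⇒≤ (strict v 0<av)
    ... | no  0≮av = subst (λ z → z * X ≤ x v * A) (≤-antisym (0≤a v) (≮⇒≥ 0≮av))
                           (subst (_≤ x v * A) (sym (*-zeroˡ X)) (*-nonNeg (0≤x v) 0≤A))

    ∑aX<∑xA : ∑[ v < k ] (a v * X) < ∑[ v < k ] (x v * A)
    ∑aX<∑xA = let j , 0<aⱼ = ∑-pos⇒∃-pos a 0<A in ∑-mono-< weak j (strict j 0<aⱼ)

open import Data.Nat using (ℕ; _≤_; _+_; _*_; _^_; _∸_)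
open import Data.Fin using (Fin)
open import Data.Bool using (T; if_then_else_)
open import Data.Product using (_×_)
open import Data.Rational using (ℚ; 0ℚ) renaming (_≤_ to _≤ℚ_)

open import Data.Bool using (Bool; true; false)
open import Data.Nat using (zero; suc; s≤s)
import Data.Nat.Properties as ℕ
open import Data.Nat.Tactic.RingSolver using (solve-∀)
open import Data.Product using (proj₁; proj₂)
import Data.Rational as ℚ
import Data.Rational.Properties as ℚ
open import Function using (_∘_)
open import Relation.Binary.PropositionalEquality
open import Algebra.Properties.CommutativeMonoid.Sum ℚ.+-0-commutativeMonoid using (sum)
import Algebra.Properties.CommutativeMonoid.Sum ℕ.+-0-commutativeMonoid as ℕΣ
open RationalFacts

if-elim : ∀ {A : Set} (P : A → Set) b {q z : A} → P z → (T b → P q) → P (if b then q else z)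
if-elim P true  _  Pq = Pq _
if-elim P false Pz _  = Pz

if-elim₂ : ∀ {A : Set} (P : A → A → Set) b {q y z : A} → P z z → (T b → P q y) →
           P (if b then q else z) (if b then y else z)
if-elim₂ P true  _   Pqy = Pqy _
if-elim₂ P false Pzz _   = Pzz

^-distribʳ-* : ∀ a b m → (a * b) ^ m ≡ a ^ m * b ^ m
^-distribʳ-* a b zero    = refl
^-distribʳ-* a b (suc m) = trans (cong (a * b *_) (^-distribʳ-* a b m)) (interchange a b (a ^ m) (b ^ m))
  where
  interchange : ∀ a b c d → a * b * (c * d) ≡ a * c * (b * d)
  interchange = solve-∀

ℕ→ℚ[n*n]^[1+t] : ∀ n t → ℕ→ℚ (n * n) ^ℚ suc t ≡ ℕ→ℚ (n ^ suc (suc t)) ℚ.* ℕ→ℚ (n ^ t)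
ℕ→ℚ[n*n]^[1+t] n t = begin
  ℕ→ℚ (n * n) ^ℚ suc t                  ≡⟨ sym (ℕ→ℚ-homo-^ (n * n) (suc t)) ⟩
  ℕ→ℚ ((n * n) ^ suc t)                 ≡⟨ cong ℕ→ℚ (^-distribʳ-* n n (suc t)) ⟩
  ℕ→ℚ (n ^ suc t * n ^ suc t)           ≡⟨ cong ℕ→ℚ (shuffle n (n ^ t)) ⟩
  ℕ→ℚ (n ^ suc (suc t) * n ^ t)         ≡⟨ ℕ→ℚ-homo-* (n ^ suc (suc t)) (n ^ t) ⟩
  ℕ→ℚ (n ^ suc (suc t)) ℚ.* ℕ→ℚ (n ^ t) ∎
  where
  open ≡-Reasoning
  shuffle : ∀ n e → n * e * (n * e) ≡ n * (n * e) * e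
  shuffle = solve-∀

∑-selected≤∑ : ∀ {m} (b : Fin m → Bool) (f : Fin m → ℕ) →
               sum (λ v → if b v then ℕ→ℚ (f v) else 0ℚ) ≤ℚ ℕ→ℚ (ℕΣ.sum f)
∑-selected≤∑ b f = ℚ.≤-trans (∑-mono-≤ (λ v → if-elim (_≤ℚ ℕ→ℚ (f v)) (b v) (ℕ→ℚ-nonNeg (f v)) (λ _ → ℚ.≤-refl)))
                             (ℚ.≤-reflexive (sym (ℕ→ℚ-homo-∑ f)))

Vmed-bound : ∀ t {q : ℚ} {n d₁ D : ℕ} → q ^ℚ suc t ≤ℚ ℕ→ℚ (d₁ ^ suc (suc t)) → n ^ t * d₁ ≤ D ^ suc t →
             q ^ℚ suc t ℚ.* ℕ→ℚ (n ^ t) ≤ℚ ℕ→ℚ (d₁ * D) ^ℚ suc t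
Vmed-bound t {q} {n} {d₁} {D} qᴹ≤d₁ᵏ nᵗd₁≤Dᴹ = begin
  q ^ℚ M ℚ.* ℕ→ℚ (n ^ t)             ≤⟨ ℚ.*-monoʳ-≤-nonNeg (ℕ→ℚ (n ^ t)) {{ℚ.nonNegative (ℕ→ℚ-nonNeg (n ^ t))}} qᴹ≤d₁ᵏ ⟩
  ℕ→ℚ (d₁ ^ suc M) ℚ.* ℕ→ℚ (n ^ t)   ≡⟨ sym (ℕ→ℚ-homo-* (d₁ ^ suc M) (n ^ t)) ⟩
  ℕ→ℚ (d₁ ^ suc M * n ^ t)           ≤⟨ ℕ→ℚ-mono-≤ (ℕ.≤-trans (ℕ.≤-reflexive (shuffle d₁ (d₁ ^ M) (n ^ t)))
                                                                (ℕ.*-monoʳ-≤ (d₁ ^ M) nᵗd₁≤Dᴹ)) ⟩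
  ℕ→ℚ (d₁ ^ M * D ^ M)               ≡⟨ cong ℕ→ℚ (sym (^-distribʳ-* d₁ D M)) ⟩
  ℕ→ℚ ((d₁ * D) ^ M)                 ≡⟨ ℕ→ℚ-homo-^ (d₁ * D) M ⟩
  ℕ→ℚ (d₁ * D) ^ℚ M                  ∎
  where
  open ℚ.≤-Reasoning
  M = suc t
  shuffle : ∀ d e N → d * e * N ≡ e * (N * d)
  shuffle = solve-∀

lemma7 : (k n : ℕ) (G : Graph n) → 2 ≤ k → GirthAtLeast G (2 * k + 1) →
           (q : Fin n → ℚ) →
           (∀ v → T (inVmed G k v) → (0ℚ ≤ℚ q v) × ((q v ^ℚ (k ∸ 1)) ≤ℚ ℕ→ℚ (d G 1 v ^ k))) →
           (sumℚ (λ v → if inVmed G k v then q v else 0ℚ) ^ℚ (k ∸ 1)) ≤ℚ ℕ→ℚ (n ^ k)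
lemma7 (suc (suc t)) zero      G (s≤s (s≤s _)) _     q _  = subst (_≤ℚ ℕ→ℚ 0) (sym (0^ℚsuc t)) (ℕ→ℚ-nonNeg 0)
lemma7 (suc (suc t)) n@(suc _) G (s≤s (s≤s _)) girth q hq =
  ℚ.*-cancelʳ-≤-pos N {{ℚ.positive (ℕ→ℚ-pos (ℕ.m^n>0 n t))}} (begin
    sumℚ a ^ℚ M ℚ.* N         ≡⟨ cong (λ s → s ^ℚ M ℚ.* N) (sumℚ≡∑ a) ⟩
    sum a ^ℚ M ℚ.* N          ≤⟨ ∑-scaled-^-mono t N a x 0≤a 0≤x aᴹN≤xᴹ ⟩
    sum x ^ℚ M                ≤⟨ ^ℚ-monoˡ-≤ M (∑-nonNeg 0≤x) ∑x≤n² ⟩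
    ℕ→ℚ (n * n) ^ℚ M          ≡⟨ ℕ→ℚ[n*n]^[1+t] n t ⟩
    ℕ→ℚ (n ^ suc M) ℚ.* N     ∎)
  where
  open ℚ.≤-Reasoning
  M = suc t
  N = ℕ→ℚ (n ^ t)
  Vmed : Fin n → Bool
  Vmed = inVmed G (suc M)
  a x : Fin n → ℚ
  a v = if Vmed v then q v else 0ℚ
  x v = if Vmed v then ℕ→ℚ (d G 1 v * d G M v) else 0ℚ

  0≤a : ∀ v → 0ℚ ≤ℚ a v
  0≤a v = if-elim (0ℚ ≤ℚ_) (Vmed v) ℚ.≤-refl (proj₁ ∘ hq v)

  0≤x : ∀ v → 0ℚ ≤ℚ x v
  0≤x v = if-elim (0ℚ ≤ℚ_) (Vmed v) ℚ.≤-refl (λ _ → ℕ→ℚ-nonNeg (d G 1 v * d G M v))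

  aᴹN≤xᴹ : ∀ v → a v ^ℚ M ℚ.* N ≤ℚ x v ^ℚ M
  aᴹN≤xᴹ v = if-elim₂ (λ a x → a ^ℚ M ℚ.* N ≤ℚ x ^ℚ M) (Vmed v) (ℚ.≤-reflexive (0^ℚsuc-zeroˡ t N))
               (λ v∈Vmed → Vmed-bound t {q v} {n} {d G 1 v} {d G M v} (proj₂ (hq v v∈Vmed)) (ℕ.≤ᵇ⇒≤ _ _ v∈Vmed))

  ∑x≤n² : sum x ≤ℚ ℕ→ℚ (n * n)
  ∑x≤n² = ℚ.≤-trans (∑-selected≤∑ Vmed (λ v → d G 1 v * d G M v))
                    (ℕ→ℚ-mono-≤ (EdgeCounting.∑-degree*d≤n² G {t} (subst (GirthAtLeast G) (shape t) girth)))
    where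
    shape : ∀ t → 2 * suc (suc t) + 1 ≡ 2 * t + 5
    shape = solve-∀
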